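{- Two ribbon graphs $G$ and $H$ are twisted duals if and only if there exist $B_1,B_2,B_3\subseteq E(G)$ such that $H=G^{\tau(B_1)\delta(B_2)\tau(B_3)}$.
   Context: Ribbon graphs are represented by arrow presentations: circles (vertex boundaries) carrying, for each edge $e$, two marking arrows labelled $e$; the ribbon graph is recovered by filling circles with discs and attaching an edge disc along the two $e$-arrows so that their directions agree. For $A\subseteq E(G)$: the partial Petrial $G^{\tau(A)}$ reverses one of the two arrows of each $e\in A$ (a half-twist of each edge in $A$); the partial dual $G^{\delta(A)}$ is obtained by, for each $e\in A$ with arrows $e',e''$, drawing segments directed from the head of $e'$ to the tail of $e''$ and from the head of $e''$ to the tail of $e'$, both labelled $e$, and deleting the arcs carrying $e',e''$. Edges are identified naturally across these operations; superscripts are applied from left to right, e.g. $G^{\tau(B_1)\delta(B_2)\tau(B_3)}$ means apply $\tau(B_1)$, then $\delta(B_2)$, then $\tau(B_3)$; for a word $w_1\cdots w_r$ in $\delta,\tau$, $G^{w_1\cdots w_r(A)}$ means apply $w_1(A)$ first, then $w_2(A)$, and so on, and $1$ denotes the identity. Operations on disjoint edge sets commute. $G$ and $H$ are twisted duals if there is a partition $A_1,\dots,A_6$ of $E(G)$ (parts possibly empty) with $H=G^{1(A_1)\delta(A_2)\tau(A_3)\tau\delta(A_4)\delta\tau(A_5)\tau\delta\tau(A_6)}$. -}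

module Defs where

open import Data.Bool using (Bool; true; false; not; if_then_else_; _xor_)
open import Data.Nat using (ℕ)
open import Data.Fin using (Fin; _≟_)
open import Data.Fin.Subset using (Subset)
open import Data.Vec using (lookup; tabulate)
open import Data.Product using (Σ; _×_; _,_; proj₁; proj₂)
open import Relation.Nullary using (¬_)
open import Relation.Nullary.Decidable using (⌊_⌋)
open import Relation.Binary.PropositionalEquality using (_≡_; refl; cong; sym; trans)

-- A ribbon graph with edge set  Fin m  has 2m marking arrows: for each
-- edge e the two arrows (e , copy) with copy ∈ Bool  (false = e', true = e'').
-- Each arrow has two endpoints on its circle: tail (false) and head (true).
--
-- Going around a circle, arrows alternate with "gap" arcs; each gap arc
-- joins an endpoint of one arrow to an endpoint of the next arrow.  The
-- gap arcs form a fixed-point-free involution  gap  on the endpoints, and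
-- this determines the circles carrying arrows (they are the components of
-- arrows ∪ gaps) up to homeomorphism of the circles (including reflection
-- of a circle, which does not change the gap pairing).  Circles carrying
-- no arrows (isolated vertices) are recorded by their number.

End : Set
End = Bool × Bool          -- (copy , isHead)

Pt : ℕ → Set
Pt m = Fin m × End

record RibbonGraph (m : ℕ) : Set where
  field
    gap       : Pt m → Pt m
    gap-invol : ∀ p → gap (gap p) ≡ p
    gap-fpf   : ∀ p → ¬ (gap p ≡ p)
    isolated  : ℕ
open RibbonGraph public

-- Relabelling endpoints by a bijection.  New label q sits at the old
-- physical point  to q ; the gap arcs (physical arcs) are unchanged.

record Bij (X : Set) : Set where
  field
    to      : X → X
    from    : X → X
    from-to : ∀ x → from (to x) ≡ x
    to-from : ∀ x → to (from x) ≡ x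

relabel : ∀ {m} → Bij (Pt m) → RibbonGraph m → RibbonGraph m
relabel {m} b G = record
  { gap       = λ q → from (gap G (to q))
  ; gap-invol = λ q → trans (cong (λ z → from (gap G z)) (to-from (gap G (to q))))
                      (trans (cong from (gap-invol G (to q))) (from-to q))
  ; gap-fpf   = λ q eq → gap-fpf G (to q)
                  (trans (sym (to-from (gap G (to q)))) (cong to eq))
  ; isolated  = isolated G
  }
  where open Bij b

onEdges : ∀ {m} → Subset m → Bij End → Bij (Pt m)
onEdges {m} A σ = record
  { to = λ p → proj₁ p , f (lookup A (proj₁ p)) (proj₂ p)
  ; from = λ p → proj₁ p , g (lookup A (proj₁ p)) (proj₂ p)
  ; from-to = λ p → cong (proj₁ p ,_) (gf (lookup A (proj₁ p)) (proj₂ p))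
  ; to-from = λ p → cong (proj₁ p ,_) (fg (lookup A (proj₁ p)) (proj₂ p))
  }
  where
  open Bij σ
  f : Bool → End → End
  f true  x = to x
  f false x = x
  g : Bool → End → End
  g true  x = from x
  g false x = x
  gf : ∀ b x → g b (f b x) ≡ x
  gf true  x = from-to x
  gf false x = refl
  fg : ∀ b x → f b (g b x) ≡ x
  fg true  x = to-from x
  fg false x = refl

-- Partial Petrial: reverse the arrow e' (copy false) of each e ∈ A.

τ-end : Bij End
τ-end = record { to = t ; from = t ; from-to = tt ; to-from = tt }
  where
  t : End → End
  t (false , h) = false , not h
  t (true  , h) = true , h
  tt : ∀ x → t (t x) ≡ x
  tt (false , false) = refl
  tt (false , true)  = refl
  tt (true  , h)     = refl

-- Partial dual: arrows e' (tail t', head h') and e'' (tail t'', head h'')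
-- are replaced by new arrows  h' → t''  (new copy false) and
-- h'' → t'  (new copy true), all gap arcs being kept.
-- to : new endpoint ↦ old physical endpoint.
δ-end : Bij End
δ-end = record { to = t ; from = f ; from-to = ft ; to-from = tf }
  where
  t : End → End
  t (false , false) = false , true
  t (false , true)  = true  , false
  t (true  , false) = true  , true
  t (true  , true)  = false , false
  f : End → End
  f (false , true)  = false , false
  f (true  , false) = false , true
  f (true  , true)  = true  , false
  f (false , false) = true  , true
  ft : ∀ x → f (t x) ≡ x
  ft (false , false) = refl
  ft (false , true)  = refl
  ft (true  , false) = refl
  ft (true  , true)  = refl
  tf : ∀ x → t (f x) ≡ x
  tf (false , false) = refl
  tf (false , true)  = refl
  tf (true  , false) = refl
  tf (true  , true)  = refl

infixl 5 _^τ_ _^δ_ _^1_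

_^τ_ : ∀ {m} → RibbonGraph m → Subset m → RibbonGraph m
G ^τ A = relabel (onEdges A τ-end) G

_^δ_ : ∀ {m} → RibbonGraph m → Subset m → RibbonGraph m
G ^δ A = relabel (onEdges A δ-end) G

_^1_ : ∀ {m} → RibbonGraph m → Subset m → RibbonGraph m
G ^1 A = G

-- Equality of ribbon graphs (edges identified naturally): equivalence of
-- arrow presentations, i.e. a label-preserving homeomorphism of the circles
-- (circle reflections are invisible in the gap encoding), together with,
-- for each edge, optionally swapping the names e'/e'' and optionally
-- reversing both arrows of e.  s e = (swap copies? , reverse both?).

act : ∀ {m} → (Fin m → Bool × Bool) → Pt m → Pt m
act s (e , (c , h)) = e , (c xor proj₁ (s e) , h xor proj₂ (s e))

infix 4 _≅_
_≅_ : ∀ {m} → RibbonGraph m → RibbonGraph m → Set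
_≅_ {m} G H =
  isolated G ≡ isolated H ×
  Σ (Fin m → Bool × Bool) (λ s → ∀ p → gap H (act s p) ≡ act s (gap G p))

-- Twisted duals.  A partition A₁,…,A₆ of E(G) into six (possibly empty)
-- labelled parts is given by the function c : Fin m → Fin 6, A_i = c⁻¹(i).

part : ∀ {m} → (Fin m → Fin 6) → Fin 6 → Subset m
part c i = tabulate (λ e → ⌊ c e ≟ i ⌋)

-- G^{1(A₁) δ(A₂) τ(A₃) τδ(A₄) δτ(A₅) τδτ(A₆)}, applied left to right
twistedDualOp : ∀ {m} → RibbonGraph m → (Fin m → Fin 6) → RibbonGraph m
twistedDualOp G c =
  G ^1 A 0F ^δ A 1F ^τ A 2F
    ^τ A 3F ^δ A 3F
    ^δ A 4F ^τ A 4F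
    ^τ A 5F ^δ A 5F ^τ A 5F
  where
  A = part c
  0F 1F 2F 3F 4F 5F : Fin 6
  0F = Fin.zero
  1F = Fin.suc Fin.zero
  2F = Fin.suc (Fin.suc Fin.zero)
  3F = Fin.suc (Fin.suc (Fin.suc Fin.zero))
  4F = Fin.suc (Fin.suc (Fin.suc (Fin.suc Fin.zero)))
  5F = Fin.suc (Fin.suc (Fin.suc (Fin.suc (Fin.suc Fin.zero))))

TwistedDuals : ∀ {m} → RibbonGraph m → RibbonGraph m → Set
TwistedDuals {m} G H = Σ (Fin m → Fin 6) (λ c → H ≅ twistedDualOp G c)

-- Both sides relabel the endpoints of G edge by edge, so a ribbon graph
-- obtained from G by a word of partial Petrials and partial duals only
-- depends on the permutation of the four arrow endpoints that the word
-- induces on each edge.  Each of the six twisted-duality words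
-- 1, δ, τ, τδ, δτ, τδτ is already of the form τᵃ δᵇ τᶜ, and conversely
-- every τᵃ δᵇ τᶜ is one of the six once ττ = 1 is used.
module Submission where

open import Defs
open import Data.Bool using (Bool; true; false)
open import Data.Fin using (Fin; zero; suc; _≟_; #_)
open import Data.Fin.Subset using (Subset)
open import Data.List using (List; []; _∷_; map)
open import Data.List.Properties using (map-∘; map-cong)
open import Data.Nat using (ℕ)
open import Data.Product using (Σ; _×_; _,_; proj₁; proj₂; map₂)
open import Data.Vec using (lookup; tabulate)
open import Data.Vec.Properties using (lookup∘tabulate)
open import Function.Base using (_∘_)
open import Function.Bundles using (_⇔_; mk⇔)
open import Relation.Nullary.Decidable using (⌊_⌋)
open import Relation.Binary.PropositionalEquality
  using (_≡_; _≗_; refl; sym; trans; cong; cong₂; module ≡-Reasoning)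

private
  variable
    m : ℕ
    X : Set

idᴮ : Bij X
idᴮ = record { to = λ x → x ; from = λ x → x ; from-to = λ _ → refl ; to-from = λ _ → refl }

infixr 6 _⊙_
_⊙_ : Bij X → Bij X → Bij X
b ⊙ c = record
  { to      = Bij.to b ∘ Bij.to c
  ; from    = Bij.from c ∘ Bij.from b
  ; from-to = λ x → trans (cong (Bij.from c) (Bij.from-to b (Bij.to c x))) (Bij.from-to c x)
  ; to-from = λ x → trans (cong (Bij.to b) (Bij.to-from c (Bij.from b x))) (Bij.to-from b x)
  }

from-cong : (b c : Bij X) → Bij.to b ≗ Bij.to c → Bij.from b ≗ Bij.from c
from-cong b c to≗ x = begin
  Bij.from b x                            ≡⟨ cong (Bij.from b) (sym (Bij.to-from c x)) ⟩
  Bij.from b (Bij.to c (Bij.from c x))    ≡⟨ cong (Bij.from b) (sym (to≗ (Bij.from c x))) ⟩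
  Bij.from b (Bij.to b (Bij.from c x))    ≡⟨ Bij.from-to b (Bij.from c x) ⟩
  Bij.from c x                            ∎
  where open ≡-Reasoning

gap-relabel-cong : (b c : Bij (Pt m)) (G : RibbonGraph m) →
  Bij.to b ≗ Bij.to c → gap (relabel b G) ≗ gap (relabel c G)
gap-relabel-cong b c G to≗ q =
  trans (cong (Bij.from b ∘ gap G) (to≗ q)) (from-cong b c to≗ (gap G (Bij.to c q)))

data Op : Set where
  τ δ : Op

opEnd : Op → Bij End
opEnd τ = τ-end
opEnd δ = δ-end

Word : ℕ → Set
Word m = List (Op × Subset m)

infixl 5 _^*_
_^*_ : RibbonGraph m → Word m → RibbonGraph m
G ^* []            = G
G ^* ((o , A) ∷ w) = relabel (onEdges A (opEnd o)) G ^* w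

wordBij : Word m → Bij (Pt m)
wordBij []            = idᴮ
wordBij ((o , A) ∷ w) = onEdges A (opEnd o) ⊙ wordBij w

isolated-^* : (G : RibbonGraph m) (w : Word m) → isolated (G ^* w) ≡ isolated G
isolated-^* G []            = refl
isolated-^* G ((o , A) ∷ w) = isolated-^* (relabel (onEdges A (opEnd o)) G) w

gap-^* : (G : RibbonGraph m) (w : Word m) → gap (G ^* w) ≗ gap (relabel (wordBij w) G)
gap-^* G []            q = refl
gap-^* G ((o , A) ∷ w) q = gap-^* (relabel (onEdges A (opEnd o)) G) w q

edgewise : (Fin m → End → End) → Pt m → Pt m
edgewise φ (e , x) = e , φ e x

when : Bool → (End → End) → End → End
when true  f = f
when false f = λ x → x

runOps : List (Op × Bool) → End → End
runOps []            x = x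
runOps ((o , b) ∷ w) x = when b (Bij.to (opEnd o)) (runOps w x)

opsAt : Word m → Fin m → List (Op × Bool)
opsAt w e = map (map₂ (λ A → lookup A e)) w

to-onEdges : (A : Subset m) (σ : Bij End) →
  Bij.to (onEdges A σ) ≗ edgewise (λ e → when (lookup A e) (Bij.to σ))
to-onEdges A σ (e , x) with lookup A e
... | true  = refl
... | false = refl

to-wordBij : (w : Word m) → Bij.to (wordBij w) ≗ edgewise (runOps ∘ opsAt w)
to-wordBij []            p       = refl
to-wordBij ((o , A) ∷ w) (e , x) =
  trans (cong (Bij.to (onEdges A (opEnd o))) (to-wordBij w (e , x)))
        (to-onEdges A (opEnd o) (e , runOps (opsAt w e) x))

gap-^*-cong : (G : RibbonGraph m) (w w′ : Word m) →
  (∀ e → runOps (opsAt w e) ≗ runOps (opsAt w′ e)) → gap (G ^* w) ≗ gap (G ^* w′)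
gap-^*-cong G w w′ same q = begin
  gap (G ^* w) q                    ≡⟨ gap-^* G w q ⟩
  gap (relabel (wordBij w) G) q     ≡⟨ gap-relabel-cong (wordBij w) (wordBij w′) G to≗ q ⟩
  gap (relabel (wordBij w′) G) q    ≡⟨ sym (gap-^* G w′ q) ⟩
  gap (G ^* w′) q                   ∎
  where
  open ≡-Reasoning
  to≗ : Bij.to (wordBij w) ≗ Bij.to (wordBij w′)
  to≗ (e , x) = trans (to-wordBij w (e , x))
                      (trans (cong (e ,_) (same e x)) (sym (to-wordBij w′ (e , x))))

≅-^*-cong : (G H : RibbonGraph m) (w w′ : Word m) →
  (∀ e → runOps (opsAt w e) ≗ runOps (opsAt w′ e)) → H ≅ G ^* w → H ≅ G ^* w′
≅-^*-cong G H w w′ same (iso , s , commutes) =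
  trans iso (trans (isolated-^* G w) (sym (isolated-^* G w′))) ,
  s , λ p → trans (gap-^*-cong G w′ w (λ e x → sym (same e x)) (act s p)) (commutes p)

colourWord : (Fin m → Fin 6) → List (Op × Fin 6) → Word m
colourWord c = map (map₂ (part c))

colourOps : Fin 6 → List (Op × Fin 6) → List (Op × Bool)
colourOps j = map (map₂ (λ i → ⌊ j ≟ i ⌋))

opsAt-colourWord : (c : Fin m → Fin 6) (s : List (Op × Fin 6)) (e : Fin m) →
  opsAt (colourWord c s) e ≡ colourOps (c e) s
opsAt-colourWord c s e =
  trans (sym (map-∘ s)) (map-cong (λ (o , i) → cong (o ,_) (lookup∘tabulate _ e)) s)

-- colourWord c twistedSchema unfolds to the steps of twistedDualOp, so
-- G ^* colourWord c twistedSchema is definitionally twistedDualOp G c.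
twistedSchema : List (Op × Fin 6)
twistedSchema =
  (δ , # 1) ∷ (τ , # 2) ∷ (τ , # 3) ∷ (δ , # 3) ∷ (δ , # 4) ∷ (τ , # 4) ∷
  (τ , # 5) ∷ (δ , # 5) ∷ (τ , # 5) ∷ []

Bits : Set
Bits = Bool × Bool × Bool

τδτOps : Bits → List (Op × Bool)
τδτOps (a , b , c) = (τ , a) ∷ (δ , b) ∷ (τ , c) ∷ []

τδτ-exponents : Fin 6 → Bits
τδτ-exponents zero                                = false , false , false
τδτ-exponents (suc zero)                          = false , true  , false
τδτ-exponents (suc (suc zero))                    = true  , false , false
τδτ-exponents (suc (suc (suc zero)))              = true  , true  , false
τδτ-exponents (suc (suc (suc (suc zero))))        = false , true  , true
τδτ-exponents (suc (suc (suc (suc (suc zero))))) = true  , true  , true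

twisted≗τδτ : (j : Fin 6) →
  runOps (colourOps j twistedSchema) ≗ runOps (τδτOps (τδτ-exponents j))
twisted≗τδτ zero                                x = refl
twisted≗τδτ (suc zero)                          x = refl
twisted≗τδτ (suc (suc zero))                    x = refl
twisted≗τδτ (suc (suc (suc zero)))              x = refl
twisted≗τδτ (suc (suc (suc (suc zero))))        x = refl
twisted≗τδτ (suc (suc (suc (suc (suc zero))))) x = refl

twistedClass : Bits → Fin 6
twistedClass (false , false , false) = zero
twistedClass (true  , false , true)  = zero
twistedClass (false , true  , false) = suc zero
twistedClass (true  , false , false) = suc (suc zero)
twistedClass (false , false , true)  = suc (suc zero)
twistedClass (true  , true  , false) = suc (suc (suc zero))
twistedClass (false , true  , true)  = suc (suc (suc (suc zero)))
twistedClass (true  , true  , true)  = suc (suc (suc (suc (suc zero))))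

τδτ≗twisted : (bs : Bits) →
  runOps (τδτOps bs) ≗ runOps (colourOps (twistedClass bs) twistedSchema)
τδτ≗twisted (false , false , false) x = refl
τδτ≗twisted (true  , false , true)  x = Bij.from-to τ-end x
τδτ≗twisted (false , true  , false) x = refl
τδτ≗twisted (true  , false , false) x = refl
τδτ≗twisted (false , false , true)  x = refl
τδτ≗twisted (true  , true  , false) x = refl
τδτ≗twisted (false , true  , true)  x = refl
τδτ≗twisted (true  , true  , true)  x = refl

τδτWord : Subset m → Subset m → Subset m → Word m
τδτWord B₁ B₂ B₃ = (τ , B₁) ∷ (δ , B₂) ∷ (τ , B₃) ∷ []

bitsAt : Subset m → Subset m → Subset m → Fin m → Bits
bitsAt B₁ B₂ B₃ e = lookup B₁ e , lookup B₂ e , lookup B₃ e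

bitsAt-tabulate : (f : Fin m → Bits) (e : Fin m) →
  bitsAt (tabulate (proj₁ ∘ f)) (tabulate (proj₁ ∘ proj₂ ∘ f)) (tabulate (proj₂ ∘ proj₂ ∘ f)) e ≡ f e
bitsAt-tabulate f e =
  cong₂ _,_ (lookup∘tabulate _ e) (cong₂ _,_ (lookup∘tabulate _ e) (lookup∘tabulate _ e))

lemma2p2 : ∀ {m : ℕ} (G H : RibbonGraph m) →
    TwistedDuals G H ⇔
    Σ (Subset m) (λ B₁ → Σ (Subset m) (λ B₂ → Σ (Subset m) (λ B₃ →
    H ≅ G ^τ B₁ ^δ B₂ ^τ B₃)))
lemma2p2 G H = mk⇔ toτδτ fromτδτ
  where
  toτδτ : TwistedDuals G H → _
  toτδτ (c , H≅) = B₁ , B₂ , B₃ ,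
    ≅-^*-cong G H (colourWord c twistedSchema) (τδτWord B₁ B₂ B₃) agree H≅
    where
    f = τδτ-exponents ∘ c
    B₁ = tabulate (proj₁ ∘ f)
    B₂ = tabulate (proj₁ ∘ proj₂ ∘ f)
    B₃ = tabulate (proj₂ ∘ proj₂ ∘ f)
    agree : ∀ e → runOps (opsAt (colourWord c twistedSchema) e) ≗ runOps (τδτOps (bitsAt B₁ B₂ B₃ e))
    agree e x = begin
      runOps (opsAt (colourWord c twistedSchema) e) x  ≡⟨ cong (λ os → runOps os x) (opsAt-colourWord c twistedSchema e) ⟩
      runOps (colourOps (c e) twistedSchema) x         ≡⟨ twisted≗τδτ (c e) x ⟩
      runOps (τδτOps (f e)) x                          ≡⟨ cong (λ bs → runOps (τδτOps bs) x) (sym (bitsAt-tabulate f e)) ⟩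
      runOps (τδτOps (bitsAt B₁ B₂ B₃ e)) x            ∎
      where open ≡-Reasoning
  fromτδτ : _ → TwistedDuals G H
  fromτδτ (B₁ , B₂ , B₃ , H≅) = c ,
    ≅-^*-cong G H (τδτWord B₁ B₂ B₃) (colourWord c twistedSchema) agree H≅
    where
    c = twistedClass ∘ bitsAt B₁ B₂ B₃
    agree : ∀ e → runOps (τδτOps (bitsAt B₁ B₂ B₃ e)) ≗ runOps (opsAt (colourWord c twistedSchema) e)
    agree e x = trans (τδτ≗twisted (bitsAt B₁ B₂ B₃ e) x)
                      (cong (λ os → runOps os x) (sym (opsAt-colourWord c twistedSchema e)))
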